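{- For every $k\in\mathbb{N}$, $\mathrm{MTL}_{k+1}$ is strictly more expressive than $\mathrm{MTL}_k$, where $\mathrm{MTL}_k$ is the set of MTL formulas of until rank at most $k$.
   Context: Data words: infinite sequences $(P_0,d_0)(P_1,d_1)\dots$ with $P_i\subseteq\mathcal{P}$ (finite set of propositions) and $d_i\in\mathbb{N}$. MTL formulas: $\varphi::=p\mid\neg\varphi\mid\varphi_1\wedge\varphi_2\mid\varphi_1\mathsf{U}_I\varphi_2$, $I$ an integer interval with endpoints in $\mathbb{Z}\cup\{\pm\infty\}$; $(w,i)\models p$ iff $p\in P_i$; $(w,i)\models\varphi_1\mathsf{U}_I\varphi_2$ iff there is $j>i$ with $(w,j)\models\varphi_2$, $d_j-d_i\in I$, and $(w,k)\models\varphi_1$ for all $i<k<j$; $w\models\varphi$ iff $(w,0)\models\varphi$. Until rank: $\mathrm{urk}(p)=0$, $\mathrm{urk}(\neg\varphi)=\mathrm{urk}(\varphi)$, $\mathrm{urk}(\varphi_1\wedge\varphi_2)=\max(\mathrm{urk}\varphi_1,\mathrm{urk}\varphi_2)$, $\mathrm{urk}(\varphi_1\mathsf{U}_I\varphi_2)=\max(\mathrm{urk}\varphi_1,\mathrm{urk}\varphi_2)+1$. Strictly more expressive: every formula of the smaller logic has an equivalent (same set of satisfying data words) in the larger one, but not conversely. -}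

module Defs where

open import Data.Nat using (ℕ; zero; suc; _≤_; _<_; _⊔_)
open import Data.Integer using (ℤ; _-_) renaming (_≤_ to _≤ℤ_; +_ to ⁺_)
open import Data.Fin using (Fin)
open import Data.Maybe using (Maybe; just; nothing)
open import Data.Product using (_×_; Σ; ∃-syntax)
open import Data.Sum using (_⊎_)
open import Data.Unit using (⊤)
open import Data.Empty using (⊥)
open import Relation.Nullary using (¬_)
open import Function.Bundles using (_⇔_)
open import Data.Bool using (Bool; true)
open import Relation.Binary.PropositionalEquality using (_≡_)

-- Propositions: a finite set 𝒫 represented as Fin m.
-- A data word over 𝒫: infinite sequence (P_i , d_i), P_i ⊆ 𝒫, d_i ∈ ℕ.
record DataWord (m : ℕ) : Set where
  field
    props : ℕ → Fin m → Bool
    datum : ℕ → ℕ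

open DataWord public

-- Integer interval with endpoints in ℤ ∪ {±∞}; nothing = unbounded.
-- (Open/half-open integer endpoints are expressible as closed ones.)
record Interval : Set where
  constructor [_,_]
  field
    lower : Maybe ℤ
    upper : Maybe ℤ

LowerOK : Maybe ℤ → ℤ → Set
LowerOK nothing  z = ⊤
LowerOK (just a) z = a ≤ℤ z

UpperOK : Maybe ℤ → ℤ → Set
UpperOK nothing  z = ⊤
UpperOK (just b) z = z ≤ℤ b

_∈I_ : ℤ → Interval → Set
z ∈I [ l , u ] = LowerOK l z × UpperOK u z

data MTL (m : ℕ) : Set where
  atom  : Fin m → MTL m
  ¬'_   : MTL m → MTL m
  _∧'_  : MTL m → MTL m → MTL m
  _U⟨_⟩_ : MTL m → Interval → MTL m → MTL m

urk : ∀ {m} → MTL m → ℕ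
urk (atom p)       = 0
urk (¬' φ)         = urk φ
urk (φ ∧' ψ)       = urk φ ⊔ urk ψ
urk (φ U⟨ I ⟩ ψ)   = suc (urk φ ⊔ urk ψ)

_,_⊨_ : ∀ {m} → DataWord m → ℕ → MTL m → Set
w , i ⊨ atom p     = props w i p ≡ true
w , i ⊨ (¬' φ)     = ¬ (w , i ⊨ φ)
w , i ⊨ (φ ∧' ψ)   = (w , i ⊨ φ) × (w , i ⊨ ψ)
w , i ⊨ (φ U⟨ I ⟩ ψ) =
  ∃[ j ] (i < j × (w , j ⊨ ψ)
         × ((⁺ datum w j - ⁺ datum w i) ∈I I)
         × (∀ k → i < k → k < j → w , k ⊨ φ))

_⊨_ : ∀ {m} → DataWord m → MTL m → Set
w ⊨ φ = w , 0 ⊨ φ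

Equivalent : ∀ {m} → MTL m → MTL m → Set
Equivalent φ ψ = ∀ w → (w ⊨ φ) ⇔ (w ⊨ ψ)

MTL≤ : (m k : ℕ) → Set
MTL≤ m k = Σ (MTL m) (λ φ → urk φ ≤ k)

AtLeastAsExpressive : (m k₂ k₁ : ℕ) → Set
AtLeastAsExpressive m k₂ k₁ =
  (φ : MTL m) → urk φ ≤ k₁ → ∃[ ψ ] (urk ψ ≤ k₂ × Equivalent φ ψ)

StrictlyMoreExpressive : (m k₂ k₁ : ℕ) → Set
StrictlyMoreExpressive m k₂ k₁ =
  AtLeastAsExpressive m k₂ k₁ × ¬ AtLeastAsExpressive m k₁ k₂

-- Let every proposition hold exactly from position n on, with all data 0.
-- The suffix of this word at position i is the same word for n ∸ i, so truth
-- at a position depends only on its distance to n, and a formula of until rank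
-- r cannot distinguish two distances that both exceed r: for an until step at
-- distances a, b > r + 1, a witness at distance c ≤ r is matched by the
-- position at distance c, and every distance beyond r by induction.  The
-- formula X^(k+1) p has rank k + 1 and separates the distances k + 1 and k + 2.
module Submission where

open import Defs hiding (_⊨_)
open import Data.Nat using (ℕ; suc; zero; _+_; _∸_; _≤_; _<_; _≤ᵇ_; z≤n; z<s; s≤s; s≤s⁻¹; _<?_)
open import Data.Nat.Properties
open import Data.Bool.Properties using (T-≡)
open import Data.Integer using (ℤ; _-_) renaming (+_ to ⁺_)
open import Data.Fin using (Fin)
import Data.Fin as Fin
open import Data.Maybe using (nothing)
open import Data.Product using (_×_; _,_; ∃-syntax; map₂)
open import Data.Unit using (tt)
open import Relation.Nullary using (¬_; yes; no; contradiction)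
open import Function using (_∘_; _$_)
open import Function.Bundles using (_⇔_; mk⇔; Equivalence)
open import Function.Construct.Identity using (⇔-id)
open import Function.Construct.Composition using (_⇔-∘_)
open import Function.Construct.Symmetry using (⇔-sym)
open import Relation.Binary.PropositionalEquality using (_≡_; refl; sym; trans; cong₂; subst; subst₂)

open Equivalence

offset : ∀ {i j} → i ≤ j → ∃[ t ] (j ≡ t + i)
offset {i} {j} i≤j = j ∸ i , sym (m∸n+n≡m i≤j)

+-translateʳ-< : ∀ {x y} i i' → x + i' < y + i' → x + i < y + i
+-translateʳ-< {x} {y} i i' lt = +-monoˡ-< i (+-cancelʳ-< i' x y lt)

module _ {m : ℕ} where

  gap : DataWord m → ℕ → ℕ → ℤ
  gap w i j = ⁺ datum w j - ⁺ datum w i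

  record SameFuture (w : DataWord m) (i : ℕ) (w' : DataWord m) (i' : ℕ) : Set where
    field
      atoms : ∀ t p → (w , (t + i) ⊨ atom p) ⇔ (w' , (t + i') ⊨ atom p)
      gaps  : ∀ s t → gap w (s + i) (t + i) ≡ gap w' (s + i') (t + i')

  open SameFuture

  SameFuture-sym : ∀ {w i w' i'} → SameFuture w i w' i' → SameFuture w' i' w i
  SameFuture-sym same = record
    { atoms = λ t p → ⇔-sym (atoms same t p)
    ; gaps  = λ s t → sym (gaps same s t)
    }

  SameFuture-shift : ∀ {w i w' i'} u → SameFuture w i w' i' → SameFuture w (u + i) w' (u + i')
  SameFuture-shift {w} {i} {w'} {i'} u same = record
    { atoms = λ t p → subst₂ (λ j j' → (w , j ⊨ atom p) ⇔ (w' , j' ⊨ atom p))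
                             (+-assoc t u i) (+-assoc t u i') (atoms same (t + u) p)
    ; gaps  = λ s t → subst₂ _≡_ (cong₂ (gap w) (+-assoc s u i) (+-assoc t u i))
                                 (cong₂ (gap w') (+-assoc s u i') (+-assoc t u i'))
                                 (gaps same (s + u) (t + u))
    }

  ⊨-SameFuture : ∀ φ {w i w' i'} → SameFuture w i w' i' → w , i ⊨ φ → w' , i' ⊨ φ
  ⊨-SameFuture (atom p) same = to (atoms same 0 p)
  ⊨-SameFuture (¬' φ) same h = h ∘ ⊨-SameFuture φ (SameFuture-sym same)
  ⊨-SameFuture (φ ∧' ψ) same (hφ , hψ) = ⊨-SameFuture φ same hφ , ⊨-SameFuture ψ same hψ
  ⊨-SameFuture (φ U⟨ I ⟩ ψ) {w} {i} {w'} {i'} same (j , i<j , hψ , gap∈I , hφ) with offset (<⇒≤ i<j)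
  ... | t , refl =
    t + i' , +-translateʳ-< i' i i<j , ⊨-SameFuture ψ (SameFuture-shift t same) hψ ,
    subst (_∈I I) (gaps same 0 t) gap∈I , hφ'
    where
    hφ' : ∀ k' → i' < k' → k' < t + i' → w' , k' ⊨ φ
    hφ' k' i'<k' k'<j' with offset (<⇒≤ i'<k')
    ... | s , refl = ⊨-SameFuture φ (SameFuture-shift s same)
                       (hφ (s + i) (+-translateʳ-< i i' i'<k') (+-translateʳ-< i i' k'<j'))

module _ {m : ℕ} where

  falsum : MTL (suc m)
  falsum = atom Fin.zero ∧' (¬' atom Fin.zero)

  next : MTL (suc m) → MTL (suc m)
  next φ = falsum U⟨ [ nothing , nothing ] ⟩ φ

  ⊨-next : ∀ {w i} φ → (w , i ⊨ next φ) ⇔ (w , suc i ⊨ φ)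
  ⊨-next {w} {i} φ = mk⇔ next⇒ next⇐
    where
    next⇐ : w , suc i ⊨ φ → w , i ⊨ next φ
    next⇐ h = suc i , n<1+n i , h , (tt , tt) , λ k i<k k<1+i → contradiction (s≤s⁻¹ k<1+i) (<⇒≱ i<k)

    next⇒ : w , i ⊨ next φ → w , suc i ⊨ φ
    next⇒ (j , i<j , hφ , _ , never) with suc i <? j
    ... | yes 1+i<j = let (p , ¬p) = never (suc i) (n<1+n i) 1+i<j in contradiction p ¬p
    ... | no 1+i≮j = subst (λ x → w , x ⊨ φ) (≤-antisym (≮⇒≥ 1+i≮j) i<j) hφ

  nextⁿ : ℕ → MTL (suc m) → MTL (suc m)
  nextⁿ zero    φ = φ
  nextⁿ (suc a) φ = nextⁿ a (next φ)

  ⊨-nextⁿ : ∀ {w i} a φ → (w , i ⊨ nextⁿ a φ) ⇔ (w , (a + i) ⊨ φ)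
  ⊨-nextⁿ zero    φ = ⇔-id _
  ⊨-nextⁿ (suc a) φ = ⊨-next φ ⇔-∘ ⊨-nextⁿ a (next φ)

  urk-nextⁿ : ∀ a φ → urk (nextⁿ a φ) ≡ a + urk φ
  urk-nextⁿ zero    φ = refl
  urk-nextⁿ (suc a) φ = trans (urk-nextⁿ a (next φ)) (+-suc a (urk φ))

StableAbove : ℕ → (ℕ → Set) → Set
StableAbove r P = ∀ {d e} → r < d → r < e → P d → P e

-- P U Q evaluated at distance a, a later position j having distance a ∸ j.
Until : (ℕ → Set) → (ℕ → Set) → ℕ → Set
Until P Q a = ∃[ j ] (0 < j × Q (a ∸ j) × (∀ k → 0 < k → k < j → P (a ∸ k)))

until-stable : ∀ {r P Q} → StableAbove r P → StableAbove r Q → StableAbove (suc r) (Until P Q)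
until-stable {r} {P} {Q} stableP stableQ {suc a} {suc b} (s≤s r<a) (s≤s r<b) (j , 0<j , Qc , P<j)
  with r <? suc a ∸ j
... | yes r<c = 1 , z<s , stableQ r<c r<b Qc , λ k 0<k k<1 → contradiction (s≤s⁻¹ k<1) (<⇒≱ 0<k)
... | no r≮c = suc b ∸ c , m<n⇒0<n∸m c<1+b , subst Q (sym (m∸[m∸n]≡n (<⇒≤ c<1+b))) Qc , P<j'
  where
  c : ℕ
  c = suc a ∸ j

  c≤r : c ≤ r
  c≤r = ≮⇒≥ r≮c

  c<1+b : c < suc b
  c<1+b = m<n⇒m<1+n (≤-<-trans c≤r r<b)

  P<j' : ∀ k' → 0 < k' → k' < suc b ∸ c → P (suc b ∸ k')
  P<j' k' _ k'<j' with r <? suc b ∸ k'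
  ... | yes r<e = stableP r<a r<e (P<j 1 z<s (∸-cancelʳ-< (≤-<-trans c≤r r<a)))
  ... | no r≮e = subst P (m∸[m∸n]≡n e≤1+a) (P<j (suc a ∸ e) (m<n⇒0<n∸m e<1+a) k<j)
    where
    e : ℕ
    e = suc b ∸ k'

    e<1+a : e < suc a
    e<1+a = m<n⇒m<1+n (≤-<-trans (≮⇒≥ r≮e) r<a)

    e≤1+a : e ≤ suc a
    e≤1+a = <⇒≤ e<1+a

    c<e : c < e
    c<e = subst (_< e) (m∸[m∸n]≡n (<⇒≤ c<1+b)) (∸-monoʳ-< k'<j' (m∸n≤m (suc b) c))

    k<j : suc a ∸ e < j
    k<j = ∸-cancelʳ-< (subst (c <_) (sym (m∸[m∸n]≡n e≤1+a)) c<e)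

module _ {m : ℕ} where

  marker : ℕ → DataWord m
  marker n = record { props = λ i _ → n ≤ᵇ i ; datum = λ _ → 0 }

  marker-atom : ∀ {n i} p → (marker n , i ⊨ atom p) ⇔ n ≤ i
  marker-atom {n} {i} _ = mk⇔ (≤ᵇ⇒≤ n i ∘ from T-≡) (to T-≡ ∘ ≤⇒≤ᵇ)

  ≤+⇔∸≤ : ∀ n i t → n ≤ t + i ⇔ n ∸ i ≤ t
  ≤+⇔∸≤ n i t = mk⇔ (λ le → m≤n+o⇒m∸n≤o n i (subst (n ≤_) (+-comm t i) le))
                    (λ le → subst (n ≤_) (+-comm i t) (≤-trans (m≤n+m∸n n i) (+-monoʳ-≤ i le)))

  marker-suffix : ∀ n i → SameFuture (marker n) i (marker (n ∸ i)) 0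
  marker-suffix n i = record
    { atoms = λ t p → subst (λ x → (marker n , (t + i) ⊨ atom p) ⇔ (marker (n ∸ i) , x ⊨ atom p))
                            (sym (+-identityʳ t))
                            (⇔-sym (marker-atom p) ⇔-∘ (≤+⇔∸≤ n i t ⇔-∘ marker-atom p))
    ; gaps  = λ _ _ → refl
    }

  Holds : MTL m → ℕ → Set
  Holds φ n = marker n , 0 ⊨ φ

  marker-shift : ∀ φ {n i} → (marker n , i ⊨ φ) ⇔ Holds φ (n ∸ i)
  marker-shift φ {n} {i} = mk⇔ (⊨-SameFuture φ (marker-suffix n i))
                               (⊨-SameFuture φ (SameFuture-sym (marker-suffix n i)))

  marker-until : ∀ φ I ψ {n} → Holds (φ U⟨ I ⟩ ψ) n ⇔ ((⁺ 0 - ⁺ 0) ∈I I × Until (Holds φ) (Holds ψ) n)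
  marker-until φ I ψ = mk⇔
    (λ (j , 0<j , hψ , gap∈I , hφ) →
       gap∈I , j , 0<j , to (marker-shift ψ) hψ , λ k 0<k k<j → to (marker-shift φ) (hφ k 0<k k<j))
    (λ (gap∈I , j , 0<j , hψ , hφ) →
       j , 0<j , from (marker-shift ψ) hψ , gap∈I , λ k 0<k k<j → from (marker-shift φ) (hφ k 0<k k<j))

  holds-stable : ∀ φ {r} → urk φ ≤ r → StableAbove r (Holds φ)
  holds-stable (atom p) _ r<d _ h = contradiction (to (marker-atom p) h) (<⇒≱ (≤-<-trans z≤n r<d))
  holds-stable (¬' φ) rk r<d r<e h h' = h (holds-stable φ rk r<e r<d h')
  holds-stable (φ ∧' ψ) rk r<d r<e (hφ , hψ) =
    holds-stable φ (m⊔n≤o⇒m≤o (urk φ) (urk ψ) rk) r<d r<e hφ ,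
    holds-stable ψ (m⊔n≤o⇒n≤o (urk φ) (urk ψ) rk) r<d r<e hψ
  holds-stable (φ U⟨ I ⟩ ψ) (s≤s rk) r<d r<e =
    from (marker-until φ I ψ) ∘
    map₂ (until-stable (holds-stable φ (m⊔n≤o⇒m≤o (urk φ) (urk ψ) rk))
                       (holds-stable ψ (m⊔n≤o⇒n≤o (urk φ) (urk ψ) rk)) r<d r<e) ∘
    to (marker-until φ I ψ)

marker-nextⁿ : ∀ {m} a (p : Fin (suc m)) {n} → Holds (nextⁿ a (atom p)) n ⇔ n ≤ a
marker-nextⁿ a p {n} = subst (λ x → Holds (nextⁿ a (atom p)) n ⇔ n ≤ x) (+-identityʳ a)
                             (marker-atom p ⇔-∘ ⊨-nextⁿ a (atom p))

proposition4 : (m k : ℕ) → StrictlyMoreExpressive (suc m) (suc k) k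
proposition4 m k = (λ φ urkφ≤k → φ , m≤n⇒m≤1+n urkφ≤k , λ _ → ⇔-id _) , nextᵏ⁺¹-inexpressible
  where
  χ : MTL (suc m)
  χ = nextⁿ (suc k) (atom Fin.zero)

  nextᵏ⁺¹-inexpressible : ¬ AtLeastAsExpressive (suc m) k (suc k)
  nextᵏ⁺¹-inexpressible expressible with expressible χ (≤-reflexive (trans (urk-nextⁿ (suc k) _) (+-identityʳ _)))
  ... | ψ , urkψ≤k , χ⇔ψ =
    1+n≰n $ to (marker-nextⁿ (suc k) Fin.zero) $ from (χ⇔ψ (marker (2 + k))) $
    holds-stable ψ urkψ≤k (n<1+n k) (m<n⇒m<1+n (n<1+n k)) $
    to (χ⇔ψ (marker (suc k))) $ from (marker-nextⁿ (suc k) Fin.zero) ≤-refl
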